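{- Let $S$ be a nonempty string with run-length encoding $\mathrm{RLE}_S=(a_1,e_1),\ldots,(a_m,e_m)$, and for $1\le k\le m$ let $\mathrm{beg}(k)=1+\sum_{i=1}^{k-1}e_i$ and $\mathrm{end}(k)=\sum_{i=1}^{k}e_i$ be the beginning and ending positions in $S$ of the $k$-th run. Then for every MUPS $S[i..j]$ of $S$ there exists a unique integer $k$ with $1\le k\le m$ such that $\frac{i+j}{2}=\frac{\mathrm{beg}(k)+\mathrm{end}(k)}{2}$.
   Context: A string over an alphabet $\Sigma$ is indexed from 1; $S[i..j]$ is the substring from position $i$ to $j$. The run-length encoding of $S$ is $\mathrm{RLE}_S=(a_1,e_1),\ldots,(a_m,e_m)$ with $a_j\in\Sigma$, $e_j$ positive integers, $a_j\neq a_{j+1}$, such that $S=a_1^{e_1}\cdots a_m^{e_m}$; each $(a_j,e_j)$ is a run and $m$ is the size of $\mathrm{RLE}_S$. A palindrome is a string equal to its reversal. $\mathrm{occ}_S(X)$ is the number of occurrences of $X$ in $S$; $X$ is unique in $S$ if $\mathrm{occ}_S(X)=1$. A substring $P=S[i..j]$ is a minimal unique palindromic substring (MUPS) of $S$ iff (1) $P$ is a palindrome with $\mathrm{occ}_S(P)=1$ and (2) either $1\le|P|\le 2$, or $|P|\ge 3$ and $\mathrm{occ}_S(S[i+1..j-1])\ge 2$. -}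

module Defs where

open import Data.Nat using (ℕ; zero; suc; _+_; _∸_; _≤_; _≥_)
open import Data.List using (List; []; _∷_; length; take; drop; replicate; concatMap; map; reverse; filterᵇ; upTo)
open import Data.List.Relation.Unary.All using (All)
open import Data.List.Relation.Unary.Linked using (Linked)
open import Data.Product using (_×_; _,_; proj₁; proj₂)
open import Relation.Binary.Definitions using (DecidableEquality)
open import Relation.Binary.PropositionalEquality using (_≡_; _≢_)
open import Relation.Nullary.Decidable using (⌊_⌋)
open import Data.List.Properties using (≡-dec)
open import Data.Sum using (_⊎_)
open import Data.Nat.ListAction using (sum)

-- Strings over an alphabet A are lists; positions are 1-based.

substr : {A : Set} → List A → ℕ → ℕ → List A
substr S i j = take (suc j ∸ i) (drop (i ∸ 1) S)

occ : {A : Set} → DecidableEquality A → List A → List A → ℕ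
occ _≟_ S X =
  length (filterᵇ (λ p → ⌊ ≡-dec _≟_ (take (length X) (drop p S)) X ⌋)
                  (upTo (suc (length S ∸ length X))))

IsPalindrome : {A : Set} → List A → Set
IsPalindrome X = reverse X ≡ X

expand : {A : Set} → List (A × ℕ) → List A
expand R = concatMap (λ r → replicate (proj₂ r) (proj₁ r)) R

IsRLE : {A : Set} → List A → List (A × ℕ) → Set
IsRLE S R =
  All (λ r → 1 ≤ proj₂ r) R ×
  Linked (λ r r' → proj₁ r ≢ proj₁ r') R ×
  expand R ≡ S

beg : {A : Set} → List (A × ℕ) → ℕ → ℕ
beg R k = suc (sum (map proj₂ (take (k ∸ 1) R)))

end : {A : Set} → List (A × ℕ) → ℕ → ℕ
end R k = sum (map proj₂ (take k R))

IsMUPS : {A : Set} → DecidableEquality A → List A → ℕ → ℕ → Set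
IsMUPS _≟_ S i j =
  (1 ≤ i × i ≤ j × j ≤ length S) ×
  IsPalindrome (substr S i j) ×
  occ _≟_ S (substr S i j) ≡ 1 ×
  (length (substr S i j) ≤ 2 ⊎
   (3 ≤ length (substr S i j) × 2 ≤ occ _≟_ S (substr S (suc i) (j ∸ 1))))

module Submission where

-- Let [B, F] be the maximal run of some letter a through the midpoint of P; reflection in
-- the centre of P preserves letters inside P. If the run were centred left of P, the
-- reflection of position F + 1 would land inside the run, so the run must cover the right
-- end of P and hence begin before P; then P = a^(d+1) also occurs one position earlier,
-- contradicting uniqueness. The other side is symmetric. Finally beg k + end k is strictly
-- increasing in k, so the run is unique.

open import Defs
open import Algebra.Properties.CommutativeSemigroup using (x∙yz≈y∙xz)
open import Data.Bool using (Bool)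
open import Data.Empty using (⊥-elim)
open import Data.List using (List; []; _∷_; length; take; drop; replicate; _++_; reverse; _∷ʳ_; filterᵇ; upTo)
open import Data.List.Properties using (unfold-reverse; length-reverse; length-replicate; length-++; length-take; length-drop; ≡-dec)
open import Data.List.Membership.Propositional using (_∈_)
open import Data.List.Membership.Propositional.Properties using (∈-upTo⁺; ∈-filter⁺)
open import Data.List.Relation.Unary.All using (All; _∷_)
open import Data.List.Relation.Unary.Any using (here)
open import Data.List.Relation.Unary.Linked using (Linked; _∷_)
import Data.List.Relation.Unary.Linked as Linked
open import Data.Maybe using (Maybe; just; nothing)
open import Data.Maybe.Properties using (just-injective)
open import Data.Nat using (ℕ; zero; suc; _+_; _∸_; _≤_; _<_; _⊓_; z≤n; s≤s; ⌊_/2⌋; ⌈_/2⌉)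
open import Data.Nat.Properties
open import Data.Nat.Tactic.RingSolver using (solve-∀)
open import Data.Product using (_×_; _,_; Σ-syntax; proj₁; proj₂)
open import Function using (_∘_)
open import Relation.Binary.Definitions using (DecidableEquality; tri<; tri≈; tri>)
open import Relation.Binary.PropositionalEquality
open import Relation.Nullary using (¬_; yes; no)
open import Relation.Nullary.Decidable using (⌊_⌋; T?; fromWitness)

private
  variable
    A : Set

⌊n/2⌋+⌊n/2⌋≤n : ∀ n → ⌊ n /2⌋ + ⌊ n /2⌋ ≤ n
⌊n/2⌋+⌊n/2⌋≤n n = ≤-trans (+-monoʳ-≤ ⌊ n /2⌋ (⌊n/2⌋≤⌈n/2⌉ n)) (≤-reflexive (⌊n/2⌋+⌈n/2⌉≡n n))

n≤1+⌊n/2⌋+⌊n/2⌋ : ∀ n → n ≤ suc (⌊ n /2⌋ + ⌊ n /2⌋)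
n≤1+⌊n/2⌋+⌊n/2⌋ n = begin
  n                            ≡⟨ sym (⌊n/2⌋+⌈n/2⌉≡n n) ⟩
  ⌊ n /2⌋ + ⌈ n /2⌉            ≤⟨ +-monoʳ-≤ ⌊ n /2⌋ (⌊n/2⌋-mono (n≤1+n (suc n))) ⟩
  ⌊ n /2⌋ + suc ⌊ n /2⌋        ≡⟨ +-suc ⌊ n /2⌋ ⌊ n /2⌋ ⟩
  suc (⌊ n /2⌋ + ⌊ n /2⌋)      ∎
  where open ≤-Reasoning

[x+t]+[x+u]≡x+[x+[t+u]] : ∀ x t u → (x + t) + (x + u) ≡ x + (x + (t + u))
[x+t]+[x+u]≡x+[x+[t+u]] = solve-∀

x+[x+1+m+m]≡1+[x+m]+[x+m] : ∀ x m → x + (x + suc (m + m)) ≡ suc ((x + m) + (x + m))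
x+[x+1+m+m]≡1+[x+m]+[x+m] = solve-∀

-- Positions are 0-based here, whereas substr, beg and end count from 1.
at : List A → ℕ → Maybe A
at []       _       = nothing
at (x ∷ xs) zero    = just x
at (x ∷ xs) (suc n) = at xs n

at-drop : ∀ (xs : List A) s t → at (drop s xs) t ≡ at xs (s + t)
at-drop xs       zero    t = refl
at-drop []       (suc s) t = refl
at-drop (x ∷ xs) (suc s) t = at-drop xs s t

at-take : ∀ (xs : List A) n t → t < n → at (take n xs) t ≡ at xs t
at-take []       (suc n) t       _         = refl
at-take (x ∷ xs) (suc n) zero    _         = refl
at-take (x ∷ xs) (suc n) (suc t) (s≤s t<n) = at-take xs n t t<n

at-++ˡ : ∀ (xs ys : List A) t → t < length xs → at (xs ++ ys) t ≡ at xs t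
at-++ˡ (x ∷ xs) ys zero    _           = refl
at-++ˡ (x ∷ xs) ys (suc t) (s≤s t<∣xs∣) = at-++ˡ xs ys t t<∣xs∣

at-++ʳ : ∀ (xs ys : List A) u → at (xs ++ ys) (length xs + u) ≡ at ys u
at-++ʳ []       ys u = refl
at-++ʳ (x ∷ xs) ys u = at-++ʳ xs ys u

at-replicate-++ : ∀ n (a : A) ys t → t < n → at (replicate n a ++ ys) t ≡ just a
at-replicate-++ (suc n) a ys zero    _         = refl
at-replicate-++ (suc n) a ys (suc t) (s≤s t<n) = at-replicate-++ n a ys t t<n

at-replicate-++ʳ : ∀ n (a : A) ys u → at (replicate n a ++ ys) (n + u) ≡ at ys u
at-replicate-++ʳ zero    a ys u = refl
at-replicate-++ʳ (suc n) a ys u = at-replicate-++ʳ n a ys u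

at-replicate-++-end : ∀ n (a : A) ys → at (replicate n a ++ ys) n ≡ at ys 0
at-replicate-++-end zero    a ys = refl
at-replicate-++-end (suc n) a ys = at-replicate-++-end n a ys

at≡just⇒< : ∀ (xs : List A) p {a} → at xs p ≡ just a → p < length xs
at≡just⇒< (x ∷ xs) zero    _  = s≤s z≤n
at≡just⇒< (x ∷ xs) (suc p) eq = s≤s (at≡just⇒< xs p eq)

at-reverse : ∀ (xs : List A) t → t < length xs → at (reverse xs) t ≡ at xs (length xs ∸ suc t)
at-reverse (x ∷ xs) t t<∣x∷xs∣ rewrite unfold-reverse x xs with <-cmp t (length xs)
... | tri< t<∣xs∣ _ _ = begin
  at (reverse xs ∷ʳ x) t            ≡⟨ at-++ˡ (reverse xs) _ t (subst (t <_) (sym (length-reverse xs)) t<∣xs∣) ⟩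
  at (reverse xs) t                 ≡⟨ at-reverse xs t t<∣xs∣ ⟩
  at xs (length xs ∸ suc t)         ≡⟨ cong (at (x ∷ xs)) (sym (+-∸-assoc 1 t<∣xs∣)) ⟩
  at (x ∷ xs) (length xs ∸ t)       ∎
  where open ≡-Reasoning
... | tri≈ _ refl _ = begin
  at (reverse xs ∷ʳ x) (length xs)                 ≡⟨ cong (at (reverse xs ∷ʳ x)) (sym (trans (+-identityʳ _) (length-reverse xs))) ⟩
  at (reverse xs ∷ʳ x) (length (reverse xs) + 0)  ≡⟨ at-++ʳ (reverse xs) _ 0 ⟩
  just x                                           ≡⟨ cong (at (x ∷ xs)) (sym (n∸n≡0 (length xs))) ⟩
  at (x ∷ xs) (length xs ∸ length xs)              ∎
  where open ≡-Reasoning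
... | tri> _ _ t>∣xs∣ = ⊥-elim (<-irrefl refl (≤-trans t<∣x∷xs∣ t>∣xs∣))

take≡replicate : ∀ n (xs : List A) {a} → (∀ t → t < n → at xs t ≡ just a) → take n xs ≡ replicate n a
take≡replicate zero    xs       _        = refl
take≡replicate (suc n) []       constant with constant 0 (s≤s z≤n)
... | ()
take≡replicate (suc n) (x ∷ xs) constant with constant 0 (s≤s z≤n)
... | refl = cong (x ∷_) (take≡replicate n xs (λ t t<n → constant (suc t) (s≤s t<n)))

length-window : ∀ (S : List A) x n → x + n ≤ length S → length (take n (drop x S)) ≡ n
length-window S x n bound = begin
  length (take n (drop x S))  ≡⟨ length-take n (drop x S) ⟩
  n ⊓ length (drop x S)       ≡⟨ cong (n ⊓_) (length-drop x S) ⟩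
  n ⊓ (length S ∸ x)          ≡⟨ m≤n⇒m⊓n≡m (m+n≤o⇒m≤o∸n n (subst (_≤ length S) (+-comm x n) bound)) ⟩
  n                           ∎
  where open ≡-Reasoning

at-window : ∀ (S : List A) x n t → t < n → at (take n (drop x S)) t ≡ at S (x + t)
at-window S x n t t<n = trans (at-take (drop x S) n t t<n) (at-drop S x t)

palindrome-mirror : ∀ (w : List A) → IsPalindrome w → ∀ t u → suc (t + u) ≡ length w → at w t ≡ at w u
palindrome-mirror w palindrome t u ∣w∣≡ = begin
  at w t                   ≡⟨ cong (λ v → at v t) (sym palindrome) ⟩
  at (reverse w) t         ≡⟨ at-reverse w t (subst (t <_) ∣w∣≡ (s≤s (m≤m+n t u))) ⟩
  at w (length w ∸ suc t)  ≡⟨ cong (λ n → at w (n ∸ suc t)) (sym ∣w∣≡) ⟩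
  at w (suc t + u ∸ suc t) ≡⟨ cong (at w) (m+n∸m≡n (suc t) u) ⟩
  at w u                   ∎
  where open ≡-Reasoning

MirrorSymmetric : (ℕ → Maybe A) → ℕ → ℕ → Set
MirrorSymmetric s x y = ∀ p q → x ≤ p → x ≤ q → p + q ≡ x + y → s p ≡ s q

palindromic-window-mirror : ∀ (S : List A) x d → x + suc d ≤ length S →
  IsPalindrome (take (suc d) (drop x S)) → MirrorSymmetric (at S) x (x + d)
palindromic-window-mirror S x d bound palindrome p q x≤p x≤q p+q≡
  with m≤n⇒∃[o]m+o≡n x≤p | m≤n⇒∃[o]m+o≡n x≤q
... | t , refl | u , refl = begin
  at S (x + t)                    ≡⟨ sym (at-window S x (suc d) t (s≤s (≤-trans (m≤m+n t u) (≤-reflexive t+u≡d)))) ⟩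
  at (take (suc d) (drop x S)) t  ≡⟨ palindrome-mirror _ palindrome t u (trans (cong suc t+u≡d) (sym (length-window S x (suc d) bound))) ⟩
  at (take (suc d) (drop x S)) u  ≡⟨ at-window S x (suc d) u (s≤s (≤-trans (m≤n+m u t) (≤-reflexive t+u≡d))) ⟩
  at S (x + u)                    ∎
  where
  open ≡-Reasoning
  t+u≡d : t + u ≡ d
  t+u≡d = +-cancelˡ-≡ x _ _ (+-cancelˡ-≡ x _ _ (trans (sym ([x+t]+[x+u]≡x+[x+[t+u]] x t u)) p+q≡))

distinct-members⇒2≤length : ∀ {xs : List A} {x y} → x ∈ xs → y ∈ xs → x ≢ y → 2 ≤ length xs
distinct-members⇒2≤length {xs = _ ∷ _ ∷ _} _          _          _   = s≤s (s≤s z≤n)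
distinct-members⇒2≤length {xs = _ ∷ []}    (here refl) (here refl) x≢y = ⊥-elim (x≢y refl)

occ-≥2 : ∀ (_≟_ : DecidableEquality A) (S X : List A) {n} q → length X ≡ n →
  take n (drop q S) ≡ X → take n (drop (suc q) S) ≡ X → suc q + n ≤ length S →
  2 ≤ occ _≟_ S X
occ-≥2 _≟_ S X q refl at-q at-1+q bound =
  distinct-members⇒2≤length (occurs q (≤-trans (n≤1+n _) bound) at-q)
                            (occurs (suc q) bound at-1+q) (1+n≢n ∘ sym)
  where
  matches : ℕ → Bool
  matches p = ⌊ ≡-dec _≟_ (take (length X) (drop p S)) X ⌋
  occurs : ∀ p → p + length X ≤ length S → take (length X) (drop p S) ≡ X →
    p ∈ filterᵇ matches (upTo (suc (length S ∸ length X)))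
  occurs p p+∣X∣≤∣S∣ window≡X =
    ∈-filter⁺ (T? ∘ matches) (∈-upTo⁺ (s≤s (m+n≤o⇒m≤o∸n p p+∣X∣≤∣S∣))) (fromWitness window≡X)

Constant : (ℕ → Maybe A) → A → ℕ → ℕ → Set
Constant s a lo hi = ∀ p → lo ≤ p → p ≤ hi → s p ≡ just a

constant-window : ∀ (S : List A) {a lo hi} q n → Constant (at S) a lo hi →
  lo ≤ q → q + n ≤ suc hi → take n (drop q S) ≡ replicate n a
constant-window S q n constant lo≤q bound = take≡replicate n (drop q S) λ t t<n →
  trans (at-drop S q t) (constant (q + t) (≤-trans lo≤q (m≤m+n q t)) (≤-pred (≤-trans (+-monoʳ-< q t<n) bound)))

-- A constant block of length n + 1 contains the window at two consecutive positions.
unique-window-not-in-block : ∀ (_≟_ : DecidableEquality A) (S : List A) {a} x n lo →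
  occ _≟_ S (take n (drop x S)) ≡ 1 → lo ≤ x → x ≤ suc lo → ¬ Constant (at S) a lo (lo + n)
unique-window-not-in-block _≟_ S {a} x n lo unique lo≤x x≤1+lo constant =
  <-irrefl (sym unique) (subst (λ w → 2 ≤ occ _≟_ S w) (sym (window x lo≤x x≤1+lo)) twice)
  where
  window : ∀ q → lo ≤ q → q ≤ suc lo → take n (drop q S) ≡ replicate n a
  window q lo≤q q≤1+lo = constant-window S q n constant lo≤q (+-monoˡ-≤ n q≤1+lo)
  twice : 2 ≤ occ _≟_ S (replicate n a)
  twice = occ-≥2 _≟_ S (replicate n a) lo (length-replicate n)
    (window lo ≤-refl (n≤1+n lo)) (window (suc lo) (n≤1+n lo) ≤-refl)
    (at≡just⇒< S (lo + n) (constant (lo + n) (m≤m+n lo n) ≤-refl))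

record MaximalBlock (s : ℕ → Maybe A) (a : A) (B F : ℕ) : Set where
  field
    constant      : Constant s a B F
    maximal-left  : ∀ {B'} → B ≡ suc B' → s B' ≢ just a
    maximal-right : s (suc F) ≢ just a

module _ {s : ℕ → Maybe A} {a : A} {B F : ℕ} (block : MaximalBlock s a B F) where
  open MaximalBlock block

  -- Otherwise the mirror image of position F + 1 lies in the block.
  block-covers-right-end : ∀ {x d} → MirrorSymmetric s x (x + d) → x + ⌊ d /2⌋ ≤ F →
    B + F < x + (x + d) → x + d ≤ F
  block-covers-right-end {x} {d} mirror h≤F left-of-centre with x + d ≤? F
  ... | yes y≤F = y≤F
  ... | no y≰F with m≤n⇒∃[o]m+o≡n (≰⇒> y≰F)
  ...   | t , 1+F+t≡y =
    ⊥-elim (maximal-right (trans (mirror (suc F) (x + t) x≤1+F (m≤m+n x t) reflected) (constant (x + t) B≤x+t x+t≤F)))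
    where
    open ≤-Reasoning
    m : ℕ
    m = ⌊ d /2⌋
    reflected : suc F + (x + t) ≡ x + (x + d)
    reflected = trans (x∙yz≈y∙xz +-commutativeSemigroup (suc F) x t) (cong (x +_) 1+F+t≡y)
    x≤1+F : x ≤ suc F
    x≤1+F = ≤-trans (m≤m+n x m) (≤-trans h≤F (n≤1+n F))
    B≤x+t : B ≤ x + t
    B≤x+t = +-cancelˡ-≤ F B (x + t) (≤-pred (begin
      suc (F + B)      ≡⟨ cong suc (+-comm F B) ⟩
      suc (B + F)      ≤⟨ left-of-centre ⟩
      x + (x + d)      ≡⟨ sym reflected ⟩
      suc F + (x + t)  ∎))
    x+t≤F : x + t ≤ F
    x+t≤F = +-cancelˡ-≤ F (x + t) F (≤-pred (begin
      suc F + (x + t)          ≡⟨ reflected ⟩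
      x + (x + d)              ≤⟨ +-monoʳ-≤ x (+-monoʳ-≤ x (n≤1+⌊n/2⌋+⌊n/2⌋ d)) ⟩
      x + (x + suc (m + m))    ≡⟨ x+[x+1+m+m]≡1+[x+m]+[x+m] x m ⟩
      suc ((x + m) + (x + m))  ≤⟨ s≤s (+-mono-≤ h≤F h≤F) ⟩
      suc (F + F)              ∎))

  -- Otherwise the mirror image of position B - 1 lies in the block.
  block-covers-left-end : ∀ {x d} → MirrorSymmetric s x (x + d) → B ≤ x + ⌊ d /2⌋ →
    x + (x + d) < B + F → B ≤ x
  block-covers-left-end {x} {d} mirror B≤h right-of-centre with B ≤? x
  ... | yes B≤x = B≤x
  ... | no B≰x with m≤n⇒∃[o]m+o≡n (≰⇒> B≰x)
  ...   | t , 1+x+t≡B =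
    ⊥-elim (maximal-left (sym 1+x+t≡B) (trans (mirror (x + t) (x + u) (m≤m+n x t) (m≤m+n x u) reflected)
                                              (constant (x + u) B≤x+u x+u≤F)))
    where
    open ≤-Reasoning
    m : ℕ
    m = ⌊ d /2⌋
    t<m : t < m
    t<m = +-cancelˡ-< x t m (subst (_≤ x + m) (sym 1+x+t≡B) B≤h)
    u : ℕ
    u = d ∸ t
    t+u≡d : t + u ≡ d
    t+u≡d = m+[n∸m]≡n (≤-trans (<⇒≤ t<m) (⌊n/2⌋≤n d))
    reflected : (x + t) + (x + u) ≡ x + (x + d)
    reflected = trans ([x+t]+[x+u]≡x+[x+[t+u]] x t u) (cong (λ n → x + (x + n)) t+u≡d)
    2+t≤u : suc (suc t) ≤ u
    2+t≤u = +-cancelˡ-≤ t (suc (suc t)) u (begin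
      t + suc (suc t)  ≡⟨ +-suc t (suc t) ⟩
      suc t + suc t    ≤⟨ +-mono-≤ t<m t<m ⟩
      m + m            ≤⟨ ⌊n/2⌋+⌊n/2⌋≤n d ⟩
      d                ≡⟨ sym t+u≡d ⟩
      t + u            ∎)
    B≤x+u : B ≤ x + u
    B≤x+u = begin
      B            ≡⟨ sym 1+x+t≡B ⟩
      suc (x + t)  ≡⟨ sym (+-suc x t) ⟩
      x + suc t    ≤⟨ +-monoʳ-≤ x (≤-trans (n≤1+n (suc t)) 2+t≤u) ⟩
      x + u        ∎
    x+u≤F : x + u ≤ F
    x+u≤F = +-cancelˡ-≤ (x + t) (x + u) F (≤-pred (begin
      suc ((x + t) + (x + u))  ≡⟨ cong suc reflected ⟩
      suc (x + (x + d))        ≤⟨ right-of-centre ⟩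
      B + F                    ≡⟨ cong (_+ F) (sym 1+x+t≡B) ⟩
      suc (x + t) + F          ∎))

  block-centre : ∀ {x d} → MirrorSymmetric s x (x + d) → B ≤ x + ⌊ d /2⌋ → x + ⌊ d /2⌋ ≤ F →
    (∀ {lo} → lo ≤ x → x ≤ suc lo → ¬ Constant s a lo (lo + suc d)) → B + F ≡ x + (x + d)
  block-centre {x} {d} mirror B≤h h≤F no-longer-block with <-cmp (B + F) (x + (x + d))
  ... | tri≈ _ centred _ = centred
  ... | tri< left-of-centre _ _ =
    ⊥-elim (no-longer-block (≤-trans (n≤1+n _) (≤-reflexive 1+B+o≡x)) (≤-reflexive (sym 1+B+o≡x))
      (λ p B+o≤p p≤ → constant p (≤-trans (m≤m+n B o) B+o≤p) (≤-trans p≤ (≤-trans (≤-reflexive B+o+1+d≡y) y≤F))))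
    where
    y≤F : x + d ≤ F
    y≤F = block-covers-right-end mirror h≤F left-of-centre
    B<x : B < x
    B<x = +-cancelʳ-< F B x (<-≤-trans left-of-centre (+-monoʳ-≤ x y≤F))
    o : ℕ
    o = proj₁ (m≤n⇒∃[o]m+o≡n B<x)
    1+B+o≡x : suc (B + o) ≡ x
    1+B+o≡x = proj₂ (m≤n⇒∃[o]m+o≡n B<x)
    B+o+1+d≡y : (B + o) + suc d ≡ x + d
    B+o+1+d≡y = trans (+-suc (B + o) d) (cong (_+ d) 1+B+o≡x)
  ... | tri> _ _ right-of-centre =
    ⊥-elim (no-longer-block ≤-refl (n≤1+n x)
      (λ p x≤p p≤ → constant p (≤-trans B≤x x≤p) (≤-trans p≤ (≤-trans (≤-reflexive (+-suc x d)) y<F))))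
    where
    B≤x : B ≤ x
    B≤x = block-covers-left-end mirror B≤h right-of-centre
    y<F : x + d < F
    y<F = +-cancelˡ-< x (x + d) F (<-≤-trans right-of-centre (+-monoˡ-≤ F B≤x))

NonemptyRuns : List (A × ℕ) → Set
NonemptyRuns = All (λ r → 1 ≤ proj₂ r)

DistinctAdjacent : List (A × ℕ) → Set
DistinctAdjacent = Linked (λ r r' → proj₁ r ≢ proj₁ r')

at-expand-head : ∀ {b : A} {f} R → 1 ≤ f → at (expand ((b , f) ∷ R)) 0 ≡ just b
at-expand-head R (s≤s _) = refl

first-run-maximal : ∀ (a : A) e R → DistinctAdjacent ((a , suc e) ∷ R) → NonemptyRuns R →
  MaximalBlock (at (expand ((a , suc e) ∷ R))) a 0 e
first-run-maximal a e R distinct nonempty = record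
  { constant      = λ p _ p≤e → at-replicate-++ (suc e) a (expand R) p (s≤s p≤e)
  ; maximal-left  = λ ()
  ; maximal-right = next-letter R distinct nonempty
  }
  where
  next-letter : ∀ R' → DistinctAdjacent ((a , suc e) ∷ R') → NonemptyRuns R' →
    at (expand ((a , suc e) ∷ R')) (suc e) ≢ just a
  next-letter [] _ _ eq with trans (sym (at-replicate-++-end (suc e) a [])) eq
  ... | ()
  next-letter ((b , f) ∷ R') (a≢b ∷ _) (1≤f ∷ _) eq = a≢b (sym (just-injective (begin
    just b                                            ≡⟨ sym (at-expand-head R' 1≤f) ⟩
    at (expand ((b , f) ∷ R')) 0                      ≡⟨ sym (at-replicate-++-end (suc e) a (expand ((b , f) ∷ R'))) ⟩
    at (expand ((a , suc e) ∷ (b , f) ∷ R')) (suc e)  ≡⟨ eq ⟩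
    just a                                            ∎)))
    where open ≡-Reasoning

maximal-shift-left : ∀ n (a : A) ys {b} B → (∀ {B'} → B ≡ suc B' → at ys B' ≢ just b) → (B ≡ 0 → a ≢ b) →
  ∀ {B'} → n + B ≡ suc B' → at (replicate n a ++ ys) B' ≢ just b
maximal-shift-left n a ys zero _ a≢b {B'} n+0≡1+B' eq =
  a≢b refl (just-injective (trans (sym (at-replicate-++ n a ys B' B'<n)) eq))
  where
  B'<n : B' < n
  B'<n = ≤-reflexive (trans (sym n+0≡1+B') (+-identityʳ n))
maximal-shift-left n a ys (suc B) maximal-left _ {B'} n+1+B≡1+B' eq =
  maximal-left refl (trans (sym (at-replicate-++ʳ n a ys B)) (trans (cong (at (replicate n a ++ ys)) n+B≡B') eq))
  where
  n+B≡B' : n + B ≡ B'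
  n+B≡B' = suc-injective (trans (sym (+-suc n B)) n+1+B≡1+B')

maximal-shift : ∀ n (a : A) ys {b B F} → MaximalBlock (at ys) b B F → (B ≡ 0 → a ≢ b) →
  MaximalBlock (at (replicate n a ++ ys)) b (n + B) (n + F)
maximal-shift n a ys {b} {B} {F} block a≢b = record
  { constant      = shifted
  ; maximal-left  = maximal-shift-left n a ys B maximal-left a≢b
  ; maximal-right = λ eq → maximal-right (trans (sym (at-replicate-++ʳ n a ys (suc F))) (trans (cong (at (replicate n a ++ ys)) (+-suc n F)) eq))
  }
  where
  open MaximalBlock block
  shifted : Constant (at (replicate n a ++ ys)) b (n + B) (n + F)
  shifted p n+B≤p p≤n+F with m≤n⇒∃[o]m+o≡n (m+n≤o⇒m≤o n n+B≤p)
  ... | p' , refl = trans (at-replicate-++ʳ n a ys p')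
    (constant p' (+-cancelˡ-≤ n B p' n+B≤p) (+-cancelˡ-≤ n p' F p≤n+F))

record RunAround (R : List (A × ℕ)) (p : ℕ) : Set where
  field
    k       : ℕ
    1≤k     : 1 ≤ k
    k≤∣R∣   : k ≤ length R
    letter  : A
    first   : ℕ
    last    : ℕ
    beg≡    : beg R k ≡ suc first
    end≡    : end R k ≡ suc last
    first≤p : first ≤ p
    p≤last  : p ≤ last
    maximal : MaximalBlock (at (expand R)) letter first last

beg-∷ : ∀ (r : A × ℕ) R {k} → 1 ≤ k → beg (r ∷ R) (suc k) ≡ proj₂ r + beg R k
beg-∷ r R {suc k} _ = sym (+-suc (proj₂ r) _)

runAround-∷ : ∀ (a : A) e {R p} → DistinctAdjacent ((a , suc e) ∷ R) → NonemptyRuns R →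
  RunAround R p → RunAround ((a , suc e) ∷ R) (suc e + p)
runAround-∷ a e {[]} _ _ run with ≤-trans (RunAround.1≤k run) (RunAround.k≤∣R∣ run)
... | ()
runAround-∷ a e {(b , f) ∷ R} (a≢b ∷ _) (1≤f ∷ _) run = record
  { k       = suc k
  ; 1≤k     = s≤s z≤n
  ; k≤∣R∣   = s≤s k≤∣R∣
  ; letter  = letter
  ; first   = suc e + first
  ; last    = suc e + last
  ; beg≡    = trans (beg-∷ (a , suc e) ((b , f) ∷ R) 1≤k) (trans (cong (suc e +_) beg≡) (+-suc (suc e) first))
  ; end≡    = trans (cong (suc e +_) end≡) (+-suc (suc e) last)
  ; first≤p = +-monoʳ-≤ (suc e) first≤p
  ; p≤last  = +-monoʳ-≤ (suc e) p≤last
  ; maximal = maximal-shift (suc e) a (expand ((b , f) ∷ R)) maximal a≢letter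
  }
  where
  open RunAround run
  open MaximalBlock maximal
  a≢letter : first ≡ 0 → a ≢ letter
  a≢letter first≡0 a≡letter = a≢b (just-injective (begin
    just a                       ≡⟨ cong just a≡letter ⟩
    just letter                  ≡⟨ sym (constant 0 (≤-reflexive first≡0) z≤n) ⟩
    at (expand ((b , f) ∷ R)) 0  ≡⟨ at-expand-head R 1≤f ⟩
    just b                       ∎))
    where open ≡-Reasoning

runAround : ∀ (R : List (A × ℕ)) → NonemptyRuns R → DistinctAdjacent R →
  ∀ p → p < length (expand R) → RunAround R p
runAround ((a , suc e) ∷ R) (_ ∷ nonempty) distinct p p<∣S∣ with p ≤? e
... | yes p≤e = record
  { k       = 1
  ; 1≤k     = s≤s z≤n
  ; k≤∣R∣   = s≤s z≤n
  ; letter  = a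
  ; first   = 0
  ; last    = e
  ; beg≡    = refl
  ; end≡    = +-identityʳ (suc e)
  ; first≤p = z≤n
  ; p≤last  = p≤e
  ; maximal = first-run-maximal a e R distinct nonempty
  }
... | no p≰e with m≤n⇒∃[o]m+o≡n (≰⇒> p≰e)
...   | p' , refl = runAround-∷ a e distinct nonempty (runAround R nonempty (Linked.tail distinct) p' p'<∣S'∣)
  where
  p'<∣S'∣ : p' < length (expand R)
  p'<∣S'∣ = +-cancelˡ-< (suc e) p' _ (subst (suc e + p' <_) ∣S∣≡ p<∣S∣)
    where
    ∣S∣≡ : length (expand ((a , suc e) ∷ R)) ≡ suc e + length (expand R)
    ∣S∣≡ = trans (length-++ (replicate (suc e) a)) (cong (_+ length (expand R)) (length-replicate (suc e)))

end-strictMono : ∀ (R : List (A × ℕ)) → NonemptyRuns R → ∀ {m n} → m < n → n ≤ length R → end R m < end R n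
end-strictMono ((a , e) ∷ R) (1≤e ∷ _)        {zero}  {suc n} _          _            = ≤-trans 1≤e (m≤m+n e _)
end-strictMono ((a , e) ∷ R) (_ ∷ nonempty) {suc m} {suc n} (s≤s m<n) (s≤s n≤∣R∣) =
  +-monoʳ-< e (end-strictMono R nonempty m<n n≤∣R∣)

-- beg R (suc m) reduces to suc (end R m).
beg+end-strictMono : ∀ (R : List (A × ℕ)) → NonemptyRuns R → ∀ {k k'} → 1 ≤ k → k < k' → k' ≤ length R →
  beg R k + end R k < beg R k' + end R k'
beg+end-strictMono R nonempty {suc m} {suc n} _ (s≤s m<n) n<∣R∣ =
  +-mono-< (s≤s (end-strictMono R nonempty m<n (<⇒≤ n<∣R∣))) (end-strictMono R nonempty (s≤s m<n) n<∣R∣)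

beg+end-injective : ∀ (R : List (A × ℕ)) → NonemptyRuns R → ∀ {k k'} →
  1 ≤ k → k ≤ length R → 1 ≤ k' → k' ≤ length R →
  beg R k + end R k ≡ beg R k' + end R k' → k' ≡ k
beg+end-injective R nonempty {k} {k'} 1≤k k≤∣R∣ 1≤k' k'≤∣R∣ eq with <-cmp k' k
... | tri< k'<k _ _ = ⊥-elim (<-irrefl (sym eq) (beg+end-strictMono R nonempty 1≤k' k'<k k≤∣R∣))
... | tri≈ _ k'≡k _ = k'≡k
... | tri> _ _ k<k' = ⊥-elim (<-irrefl eq (beg+end-strictMono R nonempty 1≤k k<k' k'≤∣R∣))

substr≡window : ∀ (S : List A) x d → substr S (suc x) (suc (x + d)) ≡ take (suc d) (drop x S)
substr≡window S x d = cong (λ n → take n (drop x S)) (trans (cong (_∸ x) (sym (+-suc x d))) (m+n∸m≡n x (suc d)))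

lemma4 : {A : Set} (_≟_ : DecidableEquality A) (S : List A) (R : List (A × ℕ)) →
    1 ≤ length S → IsRLE S R →
    (i j : ℕ) → IsMUPS _≟_ S i j →
    Σ[ k ∈ ℕ ] ((1 ≤ k × k ≤ length R × i + j ≡ beg R k + end R k) ×
      ((k' : ℕ) → 1 ≤ k' × k' ≤ length R × i + j ≡ beg R k' + end R k' → k' ≡ k))
lemma4 _≟_ S R _ (nonempty , distinct , refl) zero j ((() , _) , _)
lemma4 _≟_ S R _ (nonempty , distinct , refl) (suc x) j ((_ , i≤j , j≤∣S∣) , palindrome , unique , _)
  with m≤n⇒∃[o]m+o≡n i≤j
... | d , refl = k , (1≤k , k≤∣R∣ , centred) , λ k' (1≤k' , k'≤∣R∣ , centred') →
  beg+end-injective R nonempty 1≤k k≤∣R∣ 1≤k' k'≤∣R∣ (trans (sym centred) centred')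
  where
  open RunAround (runAround R nonempty distinct (x + ⌊ d /2⌋) (≤-<-trans (+-monoʳ-≤ x (⌊n/2⌋≤n d)) j≤∣S∣))
  window≡ : substr (expand R) (suc x) (suc (x + d)) ≡ take (suc d) (drop x (expand R))
  window≡ = substr≡window (expand R) x d
  first+last≡ : first + last ≡ x + (x + d)
  first+last≡ = block-centre maximal
    (palindromic-window-mirror (expand R) x d (subst (_≤ length (expand R)) (sym (+-suc x d)) j≤∣S∣)
                               (subst IsPalindrome window≡ palindrome))
    first≤p p≤last
    (unique-window-not-in-block _≟_ (expand R) x (suc d) _ (subst (λ w → occ _≟_ (expand R) w ≡ 1) window≡ unique))
  centred : suc x + suc (x + d) ≡ beg R k + end R k
  centred = begin
    suc x + suc (x + d)       ≡⟨ cong suc (+-suc x (x + d)) ⟩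
    suc (suc (x + (x + d)))   ≡⟨ cong (suc ∘ suc) (sym first+last≡) ⟩
    suc (suc (first + last))  ≡⟨ cong suc (sym (+-suc first last)) ⟩
    suc first + suc last      ≡⟨ sym (cong₂ _+_ beg≡ end≡) ⟩
    beg R k + end R k         ∎
    where open ≡-Reasoning
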